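{- Let $X$ be a set of variables, $B=\{b_1,\dots,b_k\}\subseteq\mathbb{Q}[X]$, and $C\subseteq\mathbb{Q}[X]$ a cone. Let $Y=\{y_1,\dots,y_k\}$ be variables disjoint from $X$ and define the linear map $f:\mathrm{Lin}(Y)\to\mathbb{Q}[X]$ by $f(a_0+a_1y_1+\dots+a_ky_k)=a_0+a_1b_1+\dots+a_kb_k$. Then \[ \mathrm{cp}_{\mathbb{Z}\langle B\rangle}(C)=C+f\big(\mathrm{cp}_{\mathbb{Z}\langle Y\rangle}(f^{ -1}(C))\big). \]
   Context: $\mathrm{Lin}(Y)$ is the rational linear space of polynomials of degree at most one over $Y$. $\mathbb{Z}\langle S\rangle$ denotes the set of integer linear combinations of elements of $S$. A cone is a subset (of the relevant $\mathbb{Q}$-linear space) containing $0$ and closed under addition and non-negative rational scaling. A set $D$ is closed under cutting planes w.r.t. $L$ if for all $a,b\in\mathbb{Z}$, $a>0$, $p\in L$, $ap+b\in D$ implies $p+\lfloor b/a\rfloor\in D$; $\mathrm{cp}_L(S)$ is the least cone containing $S$ that is closed under cutting planes w.r.t. $L$ (for $\mathrm{cp}_{\mathbb{Z}\langle Y\rangle}(f^{ -1}(C))$ this is taken inside $\mathrm{Lin}(Y)$, and for $\mathrm{cp}_{\mathbb{Z}\langle B\rangle}(C)$ inside $\mathbb{Q}[X]$). $f^{ -1}(C)=\{g\in\mathrm{Lin}(Y): f(g)\in C\}$. -}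

module Defs where

open import Data.Nat using (ℕ; NonZero)
open import Data.Integer using (ℤ)
open import Data.Rational using (ℚ; 0ℚ; _/_; floor; _≤_)
import Data.Rational as Q
open import Data.Rational.Properties using (+-identityˡ; *-zeroʳ)
open import Data.Fin using (Fin; zero; suc)
open import Data.Vec using (Vec; []; _∷_; map; zipWith; replicate)
open import Data.List using (List; []; _∷_; _++_)
open import Data.List.Relation.Unary.All using (All; _∷_)
open import Data.List.Relation.Unary.All.Properties using (++⁻)
open import Data.List.Relation.Binary.Permutation.Propositional using (_↭_; ↭-refl; ↭-sym)
open import Data.List.Relation.Binary.Permutation.Propositional.Properties using (¬x∷xs↭[])
open import Data.Product using (Σ; ∃; _×_; _,_; proj₁; proj₂)
open import Relation.Nullary using (¬_)
open import Relation.Binary.PropositionalEquality using (_≡_; refl; cong; cong₂; trans; sym)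
open import Data.Empty using (⊥-elim)

-- A monomial is a finite multiset of variables, represented by a list
-- taken up to permutation (_↭_).  A polynomial is a coefficient
-- function on monomials that is invariant under permutation and has
-- finite support (outside the listed monomials it vanishes).

record Poly (X : Set) : Set where
  field
    coeff      : List X → ℚ
    coeff-perm : ∀ {m m′} → m ↭ m′ → coeff m ≡ coeff m′
    support    : List (List X)
    coeff-fin  : ∀ m → All (λ s → ¬ (m ↭ s)) support → coeff m ≡ 0ℚ
open Poly public

module _ {X : Set} where

  infix 4 _≈P_
  _≈P_ : Poly X → Poly X → Set
  p ≈P q = ∀ m → coeff p m ≡ coeff q m

  infixl 6 _+P_
  _+P_ : Poly X → Poly X → Poly X
  p +P q = record
    { coeff      = λ m → coeff p m Q.+ coeff q m
    ; coeff-perm = λ e → cong₂ Q._+_ (coeff-perm p e) (coeff-perm q e)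
    ; support    = support p ++ support q
    ; coeff-fin  = λ m a → trans
        (cong₂ Q._+_ (coeff-fin p m (proj₁ (++⁻ (support p) a)))
                     (coeff-fin q m (proj₂ (++⁻ (support p) a))))
        (+-identityˡ 0ℚ)
    }

  infixl 7 _·P_
  _·P_ : ℚ → Poly X → Poly X
  r ·P p = record
    { coeff      = λ m → r Q.* coeff p m
    ; coeff-perm = λ e → cong (r Q.*_) (coeff-perm p e)
    ; support    = support p
    ; coeff-fin  = λ m a → trans (cong (r Q.*_) (coeff-fin p m a)) (*-zeroʳ r)
    }

  constCoeff : ℚ → List X → ℚ
  constCoeff r []      = r
  constCoeff r (_ ∷ _) = 0ℚ

  private
    constPerm : ∀ r {m m′ : List X} → m ↭ m′ → constCoeff r m ≡ constCoeff r m′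
    constPerm r {[]}    {[]}    e = refl
    constPerm r {[]}    {_ ∷ _} e = ⊥-elim (¬x∷xs↭[] (↭-sym e))
    constPerm r {_ ∷ _} {[]}    e = ⊥-elim (¬x∷xs↭[] e)
    constPerm r {_ ∷ _} {_ ∷ _} e = refl

    constFin : ∀ r (m : List X) → All (λ s → ¬ (m ↭ s)) ([] ∷ []) → constCoeff r m ≡ 0ℚ
    constFin r []      (n ∷ _) = ⊥-elim (n ↭-refl)
    constFin r (_ ∷ _) _       = refl

  constP : ℚ → Poly X
  constP r = record
    { coeff = constCoeff r ; coeff-perm = constPerm r
    ; support = [] ∷ [] ; coeff-fin = constFin r }

  0P : Poly X
  0P = constP 0ℚ

ιℚ : ℤ → ℚ
ιℚ z = z / 1

record LinSpace : Set₁ where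
  field
    Carrier : Set
    _≈_     : Carrier → Carrier → Set
    𝟘       : Carrier
    _⊕_     : Carrier → Carrier → Carrier
    _⊙_     : ℚ → Carrier → Carrier
    const   : ℤ → Carrier

module _ (V : LinSpace) where
  open LinSpace V

  record IsCone (D : Carrier → Set) : Set where
    field
      respects    : ∀ {p q} → p ≈ q → D p → D q
      zero∈       : D 𝟘
      +-closed    : ∀ {p q} → D p → D q → D (p ⊕ q)
      scale-closed : ∀ {r p} → 0ℚ ≤ r → D p → D (r ⊙ p)

  CPClosed : (L D : Carrier → Set) → Set
  CPClosed L D = ∀ (a : ℕ) .{{_ : NonZero a}} (b : ℤ) (p : Carrier) →
    L p → D ((ιℚ (Data.Integer.+ a) ⊙ p) ⊕ const b) → D (p ⊕ const (floor (b / a)))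

  cp : (L S : Carrier → Set) → Carrier → Set₁
  cp L S x = ∀ (D : Carrier → Set) → IsCone D → CPClosed L D →
             (∀ y → S y → D y) → D x

PolySpace : Set → LinSpace
PolySpace X = record
  { Carrier = Poly X ; _≈_ = _≈P_ ; 𝟘 = 0P ; _⊕_ = _+P_ ; _⊙_ = _·P_
  ; const = λ z → constP (ιℚ z) }

-- Lin(Y) for Y = {y_1,…,y_k}: a₀ + a₁y₁ + … + a_ky_k is represented by
-- its coefficient tuple (a₀ , (a₁,…,a_k)).

Lin : ℕ → Set
Lin k = ℚ × Vec ℚ k

LinYSpace : ℕ → LinSpace
LinYSpace k = record
  { Carrier = Lin k ; _≈_ = _≡_
  ; 𝟘 = 0ℚ , replicate _ 0ℚ
  ; _⊕_ = λ { (a , as) (b , bs) → a Q.+ b , zipWith Q._+_ as bs }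
  ; _⊙_ = λ { r (a , as) → r Q.* a , map (r Q.*_) as }
  ; const = λ z → ιℚ z , replicate _ 0ℚ }

ℤ⟨Y⟩ : (k : ℕ) → Lin k → Set
ℤ⟨Y⟩ k g = ∃ λ (n : Vec ℤ k) → g ≡ (0ℚ , map ιℚ n)

linComb : {X : Set} {k : ℕ} → Vec ℚ k → (Fin k → Poly X) → Poly X
linComb []       b = 0P
linComb (a ∷ as) b = (a ·P b zero) +P linComb as (λ i → b (suc i))

ℤ⟨_⟩ : {X : Set} {k : ℕ} → (Fin k → Poly X) → Poly X → Set
ℤ⟨ b ⟩ p = ∃ λ n → p ≈P linComb (map ιℚ n) b

fmap : {X : Set} {k : ℕ} → (Fin k → Poly X) → Lin k → Poly X
fmap b (a₀ , as) = constP a₀ +P linComb as b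

preimage : {X : Set} {k : ℕ} → (Fin k → Poly X) → (Poly X → Set) → Lin k → Set
preimage b C g = C (fmap b g)

{-# OPTIONS --safe #-}
-- Inclusion ⊇: for any cut-closed cone D ⊇ C, the preimage f⁻¹(D) is a cone
-- closed under cutting planes w.r.t. ℤ⟨Y⟩ (f is linear, fixes constants and
-- maps ℤ⟨Y⟩ onto ℤ⟨B⟩), so it contains cp(f⁻¹(C)); hence C + f(cp(f⁻¹(C))) ⊆ D.
-- Inclusion ⊆: E = C + f(cp(f⁻¹(C))) is a cone containing C, and it is closed
-- under cutting planes: if a·f(h) + b = c + f(g) with h ∈ ℤ⟨Y⟩, then
-- c = f(a·h + b − g), so a·h + b = (a·h + b − g) + g lies in cp(f⁻¹(C)), and
-- one cut yields f(h) + ⌊b/a⌋ = 0 + f(h + ⌊b/a⌋) ∈ E.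
module Submission where

open import Defs
open import Level using (0ℓ)
open import Data.Nat using (ℕ; zero; suc; NonZero)
open import Data.Fin using (Fin; zero; suc)
open import Data.Integer using (ℤ; +_)
open import Data.Rational using (ℚ; 0ℚ; 1ℚ; _≤_; floor; _/_)
import Data.Rational as Q
import Data.Rational.Properties as Qₚ
open import Data.Rational.Solver using (module +-*-Solver)
open import Data.Vec using (Vec; []; _∷_; map; zipWith; replicate)
open import Data.List using (List; []; _∷_)
open import Data.Product using (∃; ∃₂; _×_; _,_)
open import Function.Bundles using (_⇔_; mk⇔)
open import Algebra.Bundles using (CommutativeMonoid)
open import Algebra.Properties.CommutativeSemigroup
  (CommutativeMonoid.commutativeSemigroup Qₚ.+-0-commutativeMonoid) using (interchange)
open import Relation.Binary.Bundles using (Setoid)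
import Relation.Binary.Reasoning.Setoid as SetoidReasoning
open import Relation.Binary.PropositionalEquality using (_≡_; refl; cong; cong₂; trans; sym)

-1ℚ : ℚ
-1ℚ = Q.- 1ℚ

sub-add-cancel : ∀ x y → (x Q.+ -1ℚ Q.* y) Q.+ y ≡ x
sub-add-cancel = solve 2 (λ x y → (x :+ (:- con 1ℚ) :* y) :+ y := x) refl
  where open +-*-Solver

add-sub-cancel : ∀ x y → (x Q.+ y) Q.+ -1ℚ Q.* y ≡ x
add-sub-cancel = solve 2 (λ x y → (x :+ y) :+ (:- con 1ℚ) :* y := x) refl
  where open +-*-Solver

module _ {X : Set} where

  -- _≈P_ unfolds to a Π-type, so implicit polynomials cannot be inferred from
  -- it; this rigid copy makes setoid reasoning and congruence lemmas usable.
  infix 4 _≋_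
  record _≋_ (p q : Poly X) : Set where
    constructor coeffwise
    field ≋⇒≈P : p ≈P q
  open _≋_ public

  ≋-setoid : Setoid 0ℓ 0ℓ
  ≋-setoid = record
    { Carrier       = Poly X
    ; _≈_           = _≋_
    ; isEquivalence = record
      { refl  = coeffwise λ _ → refl
      ; sym   = λ (coeffwise e) → coeffwise λ m → sym (e m)
      ; trans = λ (coeffwise e) (coeffwise e′) → coeffwise λ m → trans (e m) (e′ m)
      }
    }

  module ≋ = Setoid ≋-setoid

  +P-cong : ∀ {p p′ q q′ : Poly X} → p ≋ p′ → q ≋ q′ → p +P q ≋ p′ +P q′
  +P-cong (coeffwise e) (coeffwise e′) = coeffwise λ m → cong₂ Q._+_ (e m) (e′ m)

  +P-congˡ : ∀ (p : Poly X) {q q′} → q ≋ q′ → p +P q ≋ p +P q′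
  +P-congˡ p = +P-cong (≋.refl {p})

  +P-congʳ : ∀ (r : Poly X) {p q} → p ≋ q → p +P r ≋ q +P r
  +P-congʳ r e = +P-cong e (≋.refl {r})

  ·P-congˡ : ∀ r {p q : Poly X} → p ≋ q → r ·P p ≋ r ·P q
  ·P-congˡ r (coeffwise e) = coeffwise λ m → cong (r Q.*_) (e m)

  constCoeff-0 : ∀ (m : List X) → constCoeff 0ℚ m ≡ 0ℚ
  constCoeff-0 []      = refl
  constCoeff-0 (_ ∷ _) = refl

  +P-identityˡ : ∀ (p : Poly X) → 0P +P p ≋ p
  +P-identityˡ p = coeffwise λ m →
    trans (cong (Q._+ coeff p m) (constCoeff-0 m)) (Qₚ.+-identityˡ _)

  +P-identityʳ : ∀ (p : Poly X) → p +P 0P ≋ p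
  +P-identityʳ p = coeffwise λ m →
    trans (cong (coeff p m Q.+_) (constCoeff-0 m)) (Qₚ.+-identityʳ _)

  +P-interchange : ∀ (p q r s : Poly X) → (p +P q) +P (r +P s) ≋ (p +P r) +P (q +P s)
  +P-interchange p q r s = coeffwise λ m →
    interchange (coeff p m) (coeff q m) (coeff r m) (coeff s m)

  +P-add-sub-cancel : ∀ (p q : Poly X) → (p +P q) +P -1ℚ ·P q ≋ p
  +P-add-sub-cancel p q = coeffwise λ m → add-sub-cancel (coeff p m) (coeff q m)

  ·P-distribˡ : ∀ r (p q : Poly X) → r ·P (p +P q) ≋ r ·P p +P r ·P q
  ·P-distribˡ r p q = coeffwise λ m → Qₚ.*-distribˡ-+ r (coeff p m) (coeff q m)

  ·P-distribʳ : ∀ r s (p : Poly X) → (r Q.+ s) ·P p ≋ r ·P p +P s ·P p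
  ·P-distribʳ r s p = coeffwise λ m → Qₚ.*-distribʳ-+ (coeff p m) r s

  ·P-assoc : ∀ r s (p : Poly X) → (r Q.* s) ·P p ≋ r ·P (s ·P p)
  ·P-assoc r s p = coeffwise λ m → Qₚ.*-assoc r s (coeff p m)

  ·P-zeroˡ : ∀ (p : Poly X) → 0ℚ ·P p ≋ 0P
  ·P-zeroˡ p = coeffwise λ m → trans (Qₚ.*-zeroˡ (coeff p m)) (sym (constCoeff-0 m))

  ·P-zeroʳ : ∀ r → r ·P 0P ≋ 0P
  ·P-zeroʳ r = coeffwise λ m →
    trans (cong (r Q.*_) (constCoeff-0 m)) (trans (Qₚ.*-zeroʳ r) (sym (constCoeff-0 m)))

  constP-+ : ∀ x y → constP (x Q.+ y) ≋ constP x +P constP y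
  constP-+ x y = coeffwise λ where
    []      → refl
    (_ ∷ _) → sym (Qₚ.+-identityʳ 0ℚ)

  constP-* : ∀ r x → constP (r Q.* x) ≋ r ·P constP x
  constP-* r x = coeffwise λ where
    []      → refl
    (_ ∷ _) → sym (Qₚ.*-zeroʳ r)

module _ {X : Set} where
  open SetoidReasoning (≋-setoid {X})

  linComb-zipWith-+ : ∀ {n} (as bs : Vec ℚ n) (b : Fin n → Poly X) →
    linComb (zipWith Q._+_ as bs) b ≋ linComb as b +P linComb bs b
  linComb-zipWith-+ []       []        b = ≋.sym (+P-identityˡ 0P)
  linComb-zipWith-+ (a ∷ as) (a′ ∷ bs) b = begin
    (a Q.+ a′) ·P b₀ +P linComb (zipWith Q._+_ as bs) b₊
      ≈⟨ +P-cong (·P-distribʳ a a′ b₀) (linComb-zipWith-+ as bs b₊) ⟩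
    (a ·P b₀ +P a′ ·P b₀) +P (linComb as b₊ +P linComb bs b₊)
      ≈⟨ +P-interchange (a ·P b₀) (a′ ·P b₀) (linComb as b₊) (linComb bs b₊) ⟩
    (a ·P b₀ +P linComb as b₊) +P (a′ ·P b₀ +P linComb bs b₊) ∎
    where b₀ : Poly X
          b₀ = b zero
          b₊ : Fin _ → Poly X
          b₊ = λ i → b (suc i)

  linComb-map-* : ∀ {n} r (as : Vec ℚ n) (b : Fin n → Poly X) →
    linComb (map (r Q.*_) as) b ≋ r ·P linComb as b
  linComb-map-* r []       b = ≋.sym (·P-zeroʳ r)
  linComb-map-* r (a ∷ as) b = begin
    (r Q.* a) ·P b₀ +P linComb (map (r Q.*_) as) b₊
      ≈⟨ +P-cong (·P-assoc r a b₀) (linComb-map-* r as b₊) ⟩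
    r ·P (a ·P b₀) +P r ·P linComb as b₊
      ≈⟨ ≋.sym (·P-distribˡ r (a ·P b₀) (linComb as b₊)) ⟩
    r ·P (a ·P b₀ +P linComb as b₊) ∎
    where b₀ : Poly X
          b₀ = b zero
          b₊ : Fin _ → Poly X
          b₊ = λ i → b (suc i)

  linComb-replicate-0 : ∀ n (b : Fin n → Poly X) → linComb (replicate n 0ℚ) b ≋ 0P
  linComb-replicate-0 zero    b = ≋.refl
  linComb-replicate-0 (suc n) b = begin
    0ℚ ·P b zero +P linComb (replicate n 0ℚ) (λ i → b (suc i))
      ≈⟨ +P-cong (·P-zeroˡ (b zero)) (linComb-replicate-0 n (λ i → b (suc i))) ⟩
    0P +P 0P
      ≈⟨ +P-identityˡ 0P ⟩
    0P ∎

module _ {k : ℕ} where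
  open LinSpace (LinYSpace k) using (_⊕_; _⊙_; const)

  ⊕-sub-add-cancel : ∀ (g h : Lin k) → (g ⊕ (-1ℚ ⊙ h)) ⊕ h ≡ g
  ⊕-sub-add-cancel (a , as) (c , cs) = cong₂ _,_ (sub-add-cancel a c) (coords as cs)
    where
      coords : ∀ {n} (xs ys : Vec ℚ n) →
               zipWith Q._+_ (zipWith Q._+_ xs (map (-1ℚ Q.*_) ys)) ys ≡ xs
      coords []       []       = refl
      coords (x ∷ xs) (y ∷ ys) = cong₂ _∷_ (sub-add-cancel x y) (coords xs ys)

module _ {X : Set} {k : ℕ} (b : Fin k → Poly X) where
  open LinSpace (LinYSpace k) using (_⊕_; _⊙_; 𝟘; const)
  open SetoidReasoning (≋-setoid {X})

  fmap-⊕ : ∀ g h → fmap b (g ⊕ h) ≋ fmap b g +P fmap b h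
  fmap-⊕ (a , as) (c , cs) = begin
    constP (a Q.+ c) +P linComb (zipWith Q._+_ as cs) b
      ≈⟨ +P-cong (constP-+ a c) (linComb-zipWith-+ as cs b) ⟩
    (constP a +P constP c) +P (linComb as b +P linComb cs b)
      ≈⟨ +P-interchange (constP a) (constP c) (linComb as b) (linComb cs b) ⟩
    (constP a +P linComb as b) +P (constP c +P linComb cs b) ∎

  fmap-⊙ : ∀ r g → fmap b (r ⊙ g) ≋ r ·P fmap b g
  fmap-⊙ r (a , as) = begin
    constP (r Q.* a) +P linComb (map (r Q.*_) as) b
      ≈⟨ +P-cong (constP-* r a) (linComb-map-* r as b) ⟩
    r ·P constP a +P r ·P linComb as b
      ≈⟨ ≋.sym (·P-distribˡ r (constP a) (linComb as b)) ⟩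
    r ·P (constP a +P linComb as b) ∎

  fmap-𝟘 : fmap b 𝟘 ≋ 0P
  fmap-𝟘 = ≋.trans (+P-congˡ 0P (linComb-replicate-0 k b)) (+P-identityˡ 0P)

  fmap-const : ∀ z → fmap b (const z) ≋ constP (ιℚ z)
  fmap-const z = begin
    constP (ιℚ z) +P linComb (replicate k 0ℚ) b ≈⟨ +P-congˡ (constP (ιℚ z)) (linComb-replicate-0 k b) ⟩
    constP (ιℚ z) +P 0P                         ≈⟨ +P-identityʳ (constP (ιℚ z)) ⟩
    constP (ιℚ z)                               ∎

  fmap-⊕-const : ∀ g z → fmap b (g ⊕ const z) ≋ fmap b g +P constP (ιℚ z)
  fmap-⊕-const g z = ≋.trans (fmap-⊕ g (const z)) (+P-congˡ (fmap b g) (fmap-const z))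

  fmap-homogeneous : ∀ as → fmap b (0ℚ , as) ≋ linComb as b
  fmap-homogeneous as = +P-identityˡ (linComb as b)

  fmap-ℤ⟨Y⟩⊆ℤ⟨b⟩ : ∀ {h} → ℤ⟨Y⟩ k h → ℤ⟨ b ⟩ (fmap b h)
  fmap-ℤ⟨Y⟩⊆ℤ⟨b⟩ (n , refl) = n , ≋⇒≈P (fmap-homogeneous (map ιℚ n))

  ℤ⟨b⟩⊆fmap-ℤ⟨Y⟩ : ∀ p → ℤ⟨ b ⟩ p → ∃ λ h → ℤ⟨Y⟩ k h × p ≋ fmap b h
  ℤ⟨b⟩⊆fmap-ℤ⟨Y⟩ p (n , p≈) =
    (0ℚ , map ιℚ n) , (n , refl) , ≋.trans (coeffwise p≈) (≋.sym (fmap-homogeneous (map ιℚ n)))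

  fmap-affine : ∀ r g z → fmap b ((r ⊙ g) ⊕ const z) ≋ r ·P fmap b g +P constP (ιℚ z)
  fmap-affine r g z = ≋.trans (fmap-⊕-const (r ⊙ g) z) (+P-congʳ (constP (ιℚ z)) (fmap-⊙ r g))

  preimage-isCone : ∀ {D} → IsCone (PolySpace X) D → IsCone (LinYSpace k) (preimage b D)
  preimage-isCone coneD = record
    { respects     = λ { refl x → x }
    ; zero∈        = D.respects (≋⇒≈P (≋.sym fmap-𝟘)) D.zero∈
    ; +-closed     = λ {g} {h} x y → D.respects (≋⇒≈P (≋.sym (fmap-⊕ g h))) (D.+-closed x y)
    ; scale-closed = λ {r} {g} r≥0 x →
        D.respects (≋⇒≈P (≋.sym (fmap-⊙ r g))) (D.scale-closed r≥0 x)
    }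
    where module D = IsCone coneD

  preimage-cpClosed : ∀ {D} → IsCone (PolySpace X) D → CPClosed (PolySpace X) ℤ⟨ b ⟩ D →
                      CPClosed (LinYSpace k) (ℤ⟨Y⟩ k) (preimage b D)
  preimage-cpClosed coneD cpD a z h h∈ℤ⟨Y⟩ x =
    D.respects (≋⇒≈P (≋.sym (fmap-⊕-const h (floor (z / a)))))
      (cpD a z (fmap b h) (fmap-ℤ⟨Y⟩⊆ℤ⟨b⟩ h∈ℤ⟨Y⟩)
        (D.respects (≋⇒≈P (fmap-affine (ιℚ (+ a)) h z)) x))
    where module D = IsCone coneD

module _ (V : LinSpace) (L S : LinSpace.Carrier V → Set) where
  open LinSpace V

  -- cp quantifies over all candidate sets, so it lives in Set₁; this inductive
  -- presentation lives in Set and can therefore be part of a candidate set itself.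
  data CPClosure : Carrier → Set where
    gen          : ∀ {x} → S x → CPClosure x
    resp         : ∀ {x y} → x ≈ y → CPClosure x → CPClosure y
    zero∈        : CPClosure 𝟘
    +-closed     : ∀ {x y} → CPClosure x → CPClosure y → CPClosure (x ⊕ y)
    scale-closed : ∀ {r x} → 0ℚ ≤ r → CPClosure x → CPClosure (r ⊙ x)
    cut          : ∀ (a : ℕ) .{{_ : NonZero a}} (z : ℤ) (x : Carrier) → L x →
                   CPClosure ((ιℚ (+ a) ⊙ x) ⊕ const z) →
                   CPClosure (x ⊕ const (floor (z / a)))

  CPClosure⊆cp : ∀ {x} → CPClosure x → cp V L S x
  CPClosure⊆cp (gen x∈S)           D coneD cpD S⊆D = S⊆D _ x∈S
  CPClosure⊆cp (resp e x)          D coneD cpD S⊆D =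
    IsCone.respects coneD e (CPClosure⊆cp x D coneD cpD S⊆D)
  CPClosure⊆cp zero∈               D coneD cpD S⊆D = IsCone.zero∈ coneD
  CPClosure⊆cp (+-closed x y)      D coneD cpD S⊆D =
    IsCone.+-closed coneD (CPClosure⊆cp x D coneD cpD S⊆D) (CPClosure⊆cp y D coneD cpD S⊆D)
  CPClosure⊆cp (scale-closed r≥0 x) D coneD cpD S⊆D =
    IsCone.scale-closed coneD r≥0 (CPClosure⊆cp x D coneD cpD S⊆D)
  CPClosure⊆cp (cut a z x x∈L y)   D coneD cpD S⊆D =
    cpD a z x x∈L (CPClosure⊆cp y D coneD cpD S⊆D)

module _ {X : Set} {k : ℕ} (b : Fin k → Poly X) (C : Poly X → Set) where
  open LinSpace (LinYSpace k) using (_⊕_; _⊙_; 𝟘; const)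
  open SetoidReasoning (≋-setoid {X})

  ConePlusImageᵢ : Poly X → Set
  ConePlusImageᵢ p = ∃₂ λ (c : Poly X) (g : Lin k) →
    C c × CPClosure (LinYSpace k) (ℤ⟨Y⟩ k) (preimage b C) g × p ≋ c +P fmap b g

  C⊆ConePlusImageᵢ : ∀ c → C c → ConePlusImageᵢ c
  C⊆ConePlusImageᵢ c c∈C =
    c , 𝟘 , c∈C , zero∈ , ≋.sym (≋.trans (+P-congˡ c (fmap-𝟘 b)) (+P-identityʳ c))

  ConePlusImageᵢ-isCone : IsCone (PolySpace X) C → IsCone (PolySpace X) ConePlusImageᵢ
  ConePlusImageᵢ-isCone coneC = record
    { respects     = λ {p} {q} p≈q (c , g , c∈C , g∈cp , p≋) →
        c , g , c∈C , g∈cp , ≋.trans (≋.sym (coeffwise {p = p} {q = q} p≈q)) p≋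
    ; zero∈        = C⊆ConePlusImageᵢ 0P C.zero∈
    ; +-closed     = λ {p} {q} (c , g , c∈C , g∈cp , p≋) (d , h , d∈C , h∈cp , q≋) →
        c +P d , g ⊕ h , C.+-closed c∈C d∈C , +-closed g∈cp h∈cp , (begin
          p +P q                                     ≈⟨ +P-cong p≋ q≋ ⟩
          (c +P fmap b g) +P (d +P fmap b h)         ≈⟨ +P-interchange c (fmap b g) d (fmap b h) ⟩
          (c +P d) +P (fmap b g +P fmap b h)         ≈⟨ +P-congˡ (c +P d) (≋.sym (fmap-⊕ b g h)) ⟩
          (c +P d) +P fmap b (g ⊕ h)                 ∎)
    ; scale-closed = λ {r} {p} r≥0 (c , g , c∈C , g∈cp , p≋) →
        r ·P c , r ⊙ g , C.scale-closed r≥0 c∈C , scale-closed r≥0 g∈cp , (begin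
          r ·P p                                     ≈⟨ ·P-congˡ r p≋ ⟩
          r ·P (c +P fmap b g)                       ≈⟨ ·P-distribˡ r c (fmap b g) ⟩
          r ·P c +P r ·P fmap b g                    ≈⟨ +P-congˡ (r ·P c) (≋.sym (fmap-⊙ b r g)) ⟩
          r ·P c +P fmap b (r ⊙ g)                   ∎)
    }
    where module C = IsCone coneC

  ConePlusImageᵢ-cpClosed : IsCone (PolySpace X) C → CPClosed (PolySpace X) ℤ⟨ b ⟩ ConePlusImageᵢ
  ConePlusImageᵢ-cpClosed coneC a z p p∈ℤ⟨b⟩ (c , g , c∈C , g∈cp , ap+z≋)
    with ℤ⟨b⟩⊆fmap-ℤ⟨Y⟩ b p p∈ℤ⟨b⟩
  ... | h , h∈ℤ⟨Y⟩ , p≋fh =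
    0P , h ⊕ const ⌊z/a⌋ , IsCone.zero∈ coneC , cut a z h h∈ℤ⟨Y⟩ ah+z∈cp , (begin
      p +P constP (ιℚ ⌊z/a⌋)              ≈⟨ +P-congʳ (constP (ιℚ ⌊z/a⌋)) p≋fh ⟩
      fmap b h +P constP (ιℚ ⌊z/a⌋)       ≈⟨ ≋.sym (fmap-⊕-const b h ⌊z/a⌋) ⟩
      fmap b (h ⊕ const ⌊z/a⌋)            ≈⟨ ≋.sym (+P-identityˡ (fmap b (h ⊕ const ⌊z/a⌋))) ⟩
      0P +P fmap b (h ⊕ const ⌊z/a⌋)      ∎)
    where
      ⌊z/a⌋ : ℤ
      ⌊z/a⌋ = floor (z / a)
      A : ℚ
      A = ιℚ (+ a)
      ah+z : Lin k
      ah+z = (A ⊙ h) ⊕ const z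

      c≋ : fmap b (ah+z ⊕ (-1ℚ ⊙ g)) ≋ c
      c≋ = begin
        fmap b (ah+z ⊕ (-1ℚ ⊙ g))
          ≈⟨ fmap-⊕ b ah+z (-1ℚ ⊙ g) ⟩
        fmap b ah+z +P fmap b (-1ℚ ⊙ g)
          ≈⟨ +P-cong (fmap-affine b A h z) (fmap-⊙ b -1ℚ g) ⟩
        (A ·P fmap b h +P constP (ιℚ z)) +P -1ℚ ·P fmap b g
          ≈⟨ +P-congʳ (-1ℚ ·P fmap b g) (+P-congʳ (constP (ιℚ z)) (·P-congˡ A (≋.sym p≋fh))) ⟩
        (A ·P p +P constP (ιℚ z)) +P -1ℚ ·P fmap b g
          ≈⟨ +P-congʳ (-1ℚ ·P fmap b g) ap+z≋ ⟩
        (c +P fmap b g) +P -1ℚ ·P fmap b g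
          ≈⟨ +P-add-sub-cancel c (fmap b g) ⟩
        c ∎

      ah+z∈cp : CPClosure (LinYSpace k) (ℤ⟨Y⟩ k) (preimage b C) ah+z
      ah+z∈cp = resp (⊕-sub-add-cancel ah+z g)
        (+-closed (gen (IsCone.respects coneC (≋⇒≈P (≋.sym c≋)) c∈C)) g∈cp)

  ConePlusImage : Poly X → Set₁
  ConePlusImage p = ∃₂ λ (c : Poly X) (g : Lin k) →
    C c × cp (LinYSpace k) (ℤ⟨Y⟩ k) (preimage b C) g × p ≈P c +P fmap b g

  cp⊆ConePlusImage : IsCone (PolySpace X) C → ∀ {p} → cp (PolySpace X) ℤ⟨ b ⟩ C p → ConePlusImage p
  cp⊆ConePlusImage coneC p∈cp
    with p∈cp ConePlusImageᵢ (ConePlusImageᵢ-isCone coneC) (ConePlusImageᵢ-cpClosed coneC)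
              C⊆ConePlusImageᵢ
  ... | c , g , c∈C , g∈cp , p≋ = c , g , c∈C , CPClosure⊆cp (LinYSpace k) _ _ g∈cp , ≋⇒≈P p≋

  ConePlusImage⊆cp : ∀ {p} → ConePlusImage p → cp (PolySpace X) ℤ⟨ b ⟩ C p
  ConePlusImage⊆cp (c , g , c∈C , g∈cp , p≈) D coneD cpD C⊆D =
    D.respects (λ m → sym (p≈ m)) (D.+-closed (C⊆D c c∈C) fg∈D)
    where
      module D = IsCone coneD
      fg∈D : D (fmap b g)
      fg∈D = g∈cp (preimage b D) (preimage-isCone b coneD) (preimage-cpClosed b coneD cpD)
                  (λ h → C⊆D (fmap b h))

lemma4p6 : {X : Set} {k : ℕ} (b : Fin k → Poly X) (C : Poly X → Set) →
           IsCone (PolySpace X) C →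
           (p : Poly X) →
           cp (PolySpace X) ℤ⟨ b ⟩ C p
             ⇔ (∃₂ λ (c : Poly X) (g : Lin k) →
                  C c × cp (LinYSpace k) (ℤ⟨Y⟩ k) (preimage b C) g × (p ≈P (c +P fmap b g)))
lemma4p6 b C coneC p = mk⇔ (cp⊆ConePlusImage b C coneC) (ConePlusImage⊆cp b C)
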